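{- For $1\le k\le n-1$, the number of $312$-avoiding permutations in $\mathfrak{S}_n^{\nearrow}$ having exactly $k$ cycles equals $$|\{f\in Y_n:\mathrm{IMA}(f)=k\}|=\binom{n-1}{k-1}.$$
   Context: $[n]=\{1,\dots,n\}$, $\mathfrak{S}_n$ the symmetric group on $[n]$; products of permutations are composed with the leftmost factor acting first: $(\alpha\beta)(x)=\beta(\alpha(x))$. A function $f:[n]\to[n]$ is subexceedant if $1\le f(i)\le i$ for all $i$, written $f_1\cdots f_n$; $F_n$ is the set of such functions, $\mathrm{Im}(f)=f([n])$ and $\mathrm{IMA}(f)=|\mathrm{Im}(f)|$. $\phi:F_n\to\mathfrak{S}_n$, $\phi(f)=(1,f_1)(2,f_2)\cdots(n,f_n)$ (with $(i,i)$ the identity), is a bijection. $F_n^{\nearrow}$ is the set of non-decreasing subexceedant functions on $[n]$, $\mathfrak{S}_n^{\nearrow}=\phi(F_n^{\nearrow})$. $Y_n=\{f\in F_n^{\nearrow}: f_i=i\text{ for all } i\in\mathrm{Im}(f)\}$. A permutation $\sigma$ avoids $312$ if there are no $a<b<c$ with $\sigma(b)<\sigma(c)<\sigma(a)$. -}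

module Defs where

open import Data.Bool using (Bool; true; false; _∧_; _∨_; not; if_then_else_)
open import Data.Nat using (ℕ; zero; suc; _∸_; _≤ᵇ_; _<ᵇ_; _≡ᵇ_)
open import Data.List using (List; []; _∷_; map; length; foldl; concatMap; upTo; filterᵇ)
open import Data.Bool.ListAction using (all; any)

-- Conventions.  A function g : [n] → [n] is encoded by its list of values
-- g(1) … g(n) (one-line notation).  Positions and values are 1-based.

range : ℕ → List ℕ
range n = map suc (upTo n)

-- 1-indexed lookup: at g i = g(i)  (0 if out of range; never used so)
at : List ℕ → ℕ → ℕ
at []      _             = 0
at (x ∷ _) 1             = x
at (_ ∷ xs) (suc (suc i)) = at xs (suc i)
at (_ ∷ _) zero          = 0

words : ℕ → List ℕ → List (List ℕ)
words zero    alph = [] ∷ []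
words (suc m) alph = concatMap (λ w → map (λ a → a ∷ w) alph) (words m alph)

funs : ℕ → List (List ℕ)
funs n = words n (range n)

elemᵇ : ℕ → List ℕ → Bool
elemᵇ v xs = any (λ x → x ≡ᵇ v) xs

eqListᵇ : List ℕ → List ℕ → Bool
eqListᵇ []       []       = true
eqListᵇ (x ∷ xs) (y ∷ ys) = (x ≡ᵇ y) ∧ eqListᵇ xs ys
eqListᵇ _        _        = false

-- a function g : [n] → [n] (given as an element of funs n) is a permutation
isPermᵇ : ℕ → List ℕ → Bool
isPermᵇ n σ = all (λ v → elemᵇ v σ) (range n)

subexcᵇ : ℕ → List ℕ → Bool
subexcᵇ n f = all (λ i → (1 ≤ᵇ at f i) ∧ (at f i ≤ᵇ i)) (range n)

nondecᵇ : ℕ → List ℕ → Bool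
nondecᵇ n f = all (λ i → at f i ≤ᵇ at f (suc i)) (range (n ∸ 1))

F : ℕ → List (List ℕ)
F n = filterᵇ (subexcᵇ n) (funs n)

Fnd : ℕ → List (List ℕ)
Fnd n = filterᵇ (nondecᵇ n) (F n)

swap : ℕ → ℕ → ℕ → ℕ
swap a b x = if x ≡ᵇ a then b else (if x ≡ᵇ b then a else x)

-- φ(f) = (1,f₁)(2,f₂)⋯(n,fₙ), leftmost factor acting first:
-- φ(f)(x) = (n,fₙ)( ⋯ (1,f₁)(x) ⋯ ), returned in one-line notation
phi : ℕ → List ℕ → List ℕ
phi n f = map (λ x → foldl (λ y i → swap i (at f i) y) x (range n)) (range n)

-- σ is in 𝔖_n^↗ = φ(F_n^↗)
inSnUpᵇ : ℕ → List ℕ → Bool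
inSnUpᵇ n σ = any (λ f → eqListᵇ (phi n f) σ) (Fnd n)

avoids312ᵇ : ℕ → List ℕ → Bool
avoids312ᵇ n σ =
  not (any (λ a → any (λ b → any (λ c →
        (a <ᵇ b) ∧ (b <ᵇ c) ∧ (at σ b <ᵇ at σ c) ∧ (at σ c <ᵇ at σ a))
      (range n)) (range n)) (range n))

iter : List ℕ → ℕ → ℕ → ℕ
iter σ zero    x = x
iter σ (suc j) x = at σ (iter σ j x)

orbit : ℕ → List ℕ → ℕ → List ℕ
orbit n σ x = map (λ j → iter σ j x) (upTo n)

-- number of cycles of σ (fixed points included) = number of distinct orbits,
-- counted by their least elements
cycles : ℕ → List ℕ → ℕ
cycles n σ = length (filterᵇ (λ x → all (λ y → x ≤ᵇ y) (orbit n σ x)) (range n))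

Y : ℕ → List (List ℕ)
Y n = filterᵇ (λ f → all (λ i → not (elemᵇ i f) ∨ (at f i ≡ᵇ i)) (range n)) (Fnd n)

IMA : ℕ → List ℕ → ℕ
IMA n f = length (filterᵇ (λ v → elemᵇ v f) (range n))

count312 : ℕ → ℕ → ℕ
count312 n k = length (filterᵇ
  (λ σ → isPermᵇ n σ ∧ inSnUpᵇ n σ ∧ avoids312ᵇ n σ ∧ (cycles n σ ≡ᵇ k))
  (funs n))

countY : ℕ → ℕ → ℕ
countY n k = length (filterᵇ (λ f → IMA n f ≡ᵇ k) (Y n))

-- For f ∈ Y_n the values of f cut [n] into maximal blocks [a, b] on which f is
-- constant, equal to a, and φ(f) is the product of the cycles (a a+1 … b).
-- Hence φ(f) avoids 312 and its cycles correspond to the block starts, which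
-- are exactly the image points of f.  Conversely, if a non-decreasing
-- subexceedant f first leaves Y_n at m + 1 by jumping to a value v with
-- f(m) < v ≤ m, then v − 1 < m < φ(f)⁻¹(v) is a 312 pattern of φ(f).  As φ is
-- injective, it maps {f ∈ Y_n : IMA(f) = k} onto the 312-avoiding elements of
-- 𝔖_n^↗ with k cycles.
-- An f ∈ Y_n is determined by which of the positions 2, …, n open a new
-- block, and k − 1 of them do so when IMA(f) = k.

{-# OPTIONS --safe #-}
module Submission where

open import Defs
open import Data.Nat using (ℕ; _≤_; _∸_)
open import Data.Nat.Combinatorics using (_C_)
open import Data.Product using (_×_)
open import Relation.Binary.PropositionalEquality using (_≡_)

open import Data.Bool using (Bool; true; false; T; not; _∧_; _∨_; if_then_else_)
open import Data.Bool.Properties using (T-∧; T-∨; T-≡)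
open import Data.Bool.ListAction using (all; any)
open import Data.Empty using (⊥; ⊥-elim)
open import Data.Unit using (⊤; tt)
open import Data.Nat using (zero; suc; _+_; _<_; _≤ᵇ_; _<ᵇ_; _≡ᵇ_; z≤n; s≤s)
open import Data.Nat.Combinatorics using (nCk+nC[k+1]≡[n+1]C[k+1])
open import Data.Nat.Properties
open import Data.Product using (∃-syntax; _,_; proj₁; proj₂)
open import Data.Sum using (_⊎_; inj₁; inj₂)
open import Data.List using (List; []; _∷_; [_]; _++_; _∷ʳ_; map; concatMap; length; foldl; upTo; applyUpTo; filterᵇ; cartesianProductWith)
open import Data.List.Properties using (∷-injectiveˡ; ∷-injectiveʳ; map-++; map-∘; foldl-∷ʳ; upTo-∷ʳ; length-map; length-++; length-upTo; map-applyUpTo)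
open import Data.List.Membership.Propositional using (_∈_; find; lose)
open import Data.List.Membership.Propositional.Properties
  using (∈-map⁺; ∈-map⁻; ∈-++⁺ˡ; ∈-++⁺ʳ; ∈-++⁻; ∈-applyUpTo⁺; ∈-applyUpTo⁻; ∈-filter⁺; ∈-filter⁻;
         ∈-cartesianProductWith⁺; ∈-cartesianProductWith⁻)
open import Data.List.Membership.Propositional.Properties.WithK using (unique∧set⇒bag)
open import Data.List.Relation.Binary.BagAndSetEquality using (∼bag⇒↭)
open import Data.List.Relation.Binary.Permutation.Propositional.Properties using (↭-length)
open import Data.List.Relation.Unary.All as All using (All)
open import Data.List.Relation.Unary.All.Properties using (all⁺; all⁻)
open import Data.List.Relation.Unary.Any using (here; there)
open import Data.List.Relation.Unary.Any.Properties using (any⁺; any⁻)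
open import Data.List.Relation.Unary.AllPairs using ([]; _∷_)
open import Data.List.Relation.Unary.Unique.Propositional using (Unique)
import Data.List.Relation.Unary.Unique.Propositional.Properties as Unique
open import Function using (_∘_; id; _⇔_; mk⇔; Equivalence)
open import Relation.Binary.PropositionalEquality using (refl; sym; trans; cong; cong₂; subst; subst₂; _≢_; module ≡-Reasoning)
open import Relation.Nullary using (¬_; yes; no)
open import Relation.Nullary.Decidable using (T?)

module _ {A : Set} (p : A → Bool) where

  all-elim : ∀ {xs x} → T (all p xs) → x ∈ xs → T (p x)
  all-elim {xs} h = All.lookup (all⁺ p xs h)

  all-intro : ∀ xs → (∀ {x} → x ∈ xs → T (p x)) → T (all p xs)
  all-intro xs h = all⁻ p (All.tabulate h)

  any-elim : ∀ xs → T (any p xs) → ∃[ x ] (x ∈ xs × T (p x))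
  any-elim xs h = find (any⁻ p xs h)

  any-intro : ∀ {xs x} → x ∈ xs → T (p x) → T (any p xs)
  any-intro x∈xs px = any⁺ p (lose x∈xs px)

  ∈-filterᵇ⁺ : ∀ {xs x} → x ∈ xs → T (p x) → x ∈ filterᵇ p xs
  ∈-filterᵇ⁺ = ∈-filter⁺ (T? ∘ p)

  ∈-filterᵇ⁻ : ∀ {xs x} → x ∈ filterᵇ p xs → x ∈ xs × T (p x)
  ∈-filterᵇ⁻ {xs} = ∈-filter⁻ (T? ∘ p) {xs = xs}

  filterᵇ-unique : ∀ {xs} → Unique xs → Unique (filterᵇ p xs)
  filterᵇ-unique = Unique.filter⁺ (T? ∘ p)

filterᵇ-cong : ∀ {A : Set} (p q : A → Bool) xs → (∀ {x} → x ∈ xs → p x ≡ q x) → filterᵇ p xs ≡ filterᵇ q xs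
filterᵇ-cong p q [] _ = refl
filterᵇ-cong p q (x ∷ xs) eq with p x | q x | eq (here refl)
... | true  | .true  | refl = cong (x ∷_) (filterᵇ-cong p q xs (eq ∘ there))
... | false | .false | refl = filterᵇ-cong p q xs (eq ∘ there)

T-ext : ∀ {a b} → (T a → T b) → (T b → T a) → a ≡ b
T-ext {false} {false} _ _ = refl
T-ext {false} {true}  _ g = ⊥-elim (g tt)
T-ext {true}  {false} f _ = ⊥-elim (f tt)
T-ext {true}  {true}  _ _ = refl

T-not : ∀ {b} → T (not b) ⇔ (¬ T b)
T-not {false} = mk⇔ (λ _ ()) (λ _ → tt)
T-not {true}  = mk⇔ (λ ()) (λ ¬t → ¬t tt)

length-unique : ∀ {A : Set} {xs ys : List A} → Unique xs → Unique ys →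
                (∀ {z} → z ∈ xs ⇔ z ∈ ys) → length xs ≡ length ys
length-unique xs! ys! xs⇔ys = ↭-length (∼bag⇒↭ (unique∧set⇒bag xs! ys! xs⇔ys))

map-unique-on : ∀ {A B : Set} (h : A → B) {xs} → (∀ {x y} → x ∈ xs → y ∈ xs → h x ≡ h y → x ≡ y) →
                Unique xs → Unique (map h xs)
map-unique-on h {[]} _ [] = []
map-unique-on h {x ∷ xs} inj (x∉xs ∷ xs!) =
  All.tabulate distinct ∷ map-unique-on h (λ a b → inj (there a) (there b)) xs!
  where
  distinct : ∀ {z} → z ∈ map h xs → ¬ h x ≡ z
  distinct z∈ with ∈-map⁻ h z∈
  ... | y , y∈xs , refl = λ e → All.lookup x∉xs y∈xs (inj (here refl) (there y∈xs) e)

∈-range⁻ : ∀ {n x} → x ∈ range n → 1 ≤ x × x ≤ n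
∈-range⁻ x∈ with ∈-map⁻ suc x∈
... | _ , y∈ , refl with ∈-applyUpTo⁻ id y∈
...   | _ , i<n , refl = s≤s z≤n , i<n

∈-range⁺ : ∀ {n x} → 1 ≤ x → x ≤ n → x ∈ range n
∈-range⁺ {x = suc x} _ x≤n = ∈-map⁺ suc (∈-applyUpTo⁺ id x≤n)

range-unique : ∀ n → Unique (range n)
range-unique n = Unique.map⁺ suc-injective (Unique.upTo⁺ n)

range-∷ʳ : ∀ m → range (suc m) ≡ range m ∷ʳ suc m
range-∷ʳ m = trans (cong (map suc) (sym (upTo-∷ʳ m))) (map-++ suc (upTo m) [ m ])

range-∷ : ∀ m → range (suc m) ≡ 1 ∷ map suc (range m)
range-∷ m = cong (λ l → 1 ∷ map suc l) (sym (map-applyUpTo id suc m))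

length-range : ∀ n → length (range n) ≡ n
length-range n = trans (length-map suc (upTo n)) (length-upTo n)

at-map-applyUpTo : ∀ (h f : ℕ → ℕ) n i → i < n → at (map h (applyUpTo f n)) (suc i) ≡ h (f i)
at-map-applyUpTo h f (suc n) zero    _         = refl
at-map-applyUpTo h f (suc n) (suc i) (s≤s i<n) = at-map-applyUpTo h (f ∘ suc) n i i<n

at-map-range : ∀ (h : ℕ → ℕ) n x → 1 ≤ x → x ≤ n → at (map h (range n)) x ≡ h x
at-map-range h n (suc x) _ x≤n =
  trans (cong (λ l → at l (suc x)) (sym (map-∘ {g = h} {f = suc} (upTo n))))
        (at-map-applyUpTo (h ∘ suc) id n x x≤n)

at-∷ : ∀ x xs t → 1 ≤ t → at (x ∷ xs) (suc t) ≡ at xs t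
at-∷ x xs (suc t) _ = refl

at-∈ : ∀ f t → 1 ≤ t → t ≤ length f → at f t ∈ f
at-∈ (x ∷ f) (suc zero)    _ _         = here refl
at-∈ (x ∷ f) (suc (suc t)) _ (s≤s t≤) = there (at-∈ f (suc t) (s≤s z≤n) t≤)

∈⇒at : ∀ f {x} → x ∈ f → ∃[ t ] (1 ≤ t × t ≤ length f × at f t ≡ x)
∈⇒at (y ∷ f) (here refl) = 1 , s≤s z≤n , s≤s z≤n , refl
∈⇒at (y ∷ f) (there x∈f) with ∈⇒at f x∈f
... | suc t , _ , t≤ , eq = suc (suc t) , s≤s z≤n , s≤s t≤ , eq

at-ext : ∀ f f′ → length f ≡ length f′ → (∀ t → 1 ≤ t → t ≤ length f → at f t ≡ at f′ t) → f ≡ f′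
at-ext []      []       _   _  = refl
at-ext (x ∷ f) (y ∷ f′) len eq =
  cong₂ _∷_ (eq 1 (s≤s z≤n) (s≤s z≤n))
    (at-ext f f′ (suc-injective len) λ { (suc t) _ t≤ → eq (suc (suc t)) (s≤s z≤n) (s≤s t≤) })

elemᵇ-sound : ∀ v f → T (elemᵇ v f) → ∃[ t ] (1 ≤ t × t ≤ length f × at f t ≡ v)
elemᵇ-sound v f h with any-elim (_≡ᵇ v) f h
... | x , x∈f , x≡v with ∈⇒at f x∈f
...   | t , 1≤t , t≤ , eq = t , 1≤t , t≤ , trans eq (≡ᵇ⇒≡ x v x≡v)

elemᵇ-complete : ∀ v f t → 1 ≤ t → t ≤ length f → at f t ≡ v → T (elemᵇ v f)
elemᵇ-complete v f t 1≤t t≤ refl = any-intro (_≡ᵇ v) (at-∈ f t 1≤t t≤) (≡⇒≡ᵇ v v refl)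

eqListᵇ-sound : ∀ a b → T (eqListᵇ a b) → a ≡ b
eqListᵇ-sound []      []      _ = refl
eqListᵇ-sound (x ∷ a) (y ∷ b) h with Equivalence.to (T-∧ {x ≡ᵇ y}) h
... | x≡y , a≡b = cong₂ _∷_ (≡ᵇ⇒≡ x y x≡y) (eqListᵇ-sound a b a≡b)

eqListᵇ-refl : ∀ a → T (eqListᵇ a a)
eqListᵇ-refl []      = tt
eqListᵇ-refl (x ∷ a) = Equivalence.from (T-∧ {x ≡ᵇ x}) (≡⇒≡ᵇ x x refl , eqListᵇ-refl a)

words-∷ : ∀ m alph → words (suc m) alph ≡ cartesianProductWith (λ w a → a ∷ w) (words m alph) alph
words-∷ m alph = concatMap≡cartesianProduct (words m alph)
  where
  concatMap≡cartesianProduct : ∀ ws → concatMap (λ w → map (_∷ w) alph) ws ≡ cartesianProductWith (λ w a → a ∷ w) ws alph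
  concatMap≡cartesianProduct []       = refl
  concatMap≡cartesianProduct (w ∷ ws) = cong (map (_∷ w) alph ++_) (concatMap≡cartesianProduct ws)

words-unique : ∀ m alph → Unique alph → Unique (words m alph)
words-unique zero    alph _     = All.[] ∷ []
words-unique (suc m) alph alph! rewrite words-∷ m alph =
  Unique.cartesianProductWith⁺ (λ w a → a ∷ w) (λ { refl → refl , refl }) (words-unique m alph alph!) alph!

∈-words⁻ : ∀ m alph {w} → w ∈ words m alph → length w ≡ m × (∀ {x} → x ∈ w → x ∈ alph)
∈-words⁻ zero    alph (here refl) = refl , λ ()
∈-words⁻ (suc m) alph w∈ rewrite words-∷ m alph with ∈-cartesianProductWith⁻ (λ w a → a ∷ w) (words m alph) alph w∈
... | w′ , a , w′∈ , a∈ , refl with ∈-words⁻ m alph w′∈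
...   | len , ⊆alph = cong suc len , λ { (here refl) → a∈ ; (there x∈) → ⊆alph x∈ }

∈-words⁺ : ∀ m alph w → length w ≡ m → (∀ {x} → x ∈ w → x ∈ alph) → w ∈ words m alph
∈-words⁺ zero    alph []      refl _     = here refl
∈-words⁺ (suc m) alph (a ∷ w) refl ⊆alph rewrite words-∷ m alph =
  ∈-cartesianProductWith⁺ (λ w a → a ∷ w) (∈-words⁺ m alph w refl (⊆alph ∘ there)) (⊆alph (here refl))

funs-unique : ∀ n → Unique (funs n)
funs-unique n = words-unique n (range n) (range-unique n)

∈-funs⁻ : ∀ n {w} → w ∈ funs n → length w ≡ n × (∀ t → 1 ≤ t → t ≤ n → 1 ≤ at w t × at w t ≤ n)
∈-funs⁻ n w∈ with ∈-words⁻ n (range n) w∈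
... | refl , ⊆range = refl , λ t 1≤t t≤n → ∈-range⁻ (⊆range (at-∈ _ t 1≤t t≤n))

∈-funs⁺ : ∀ n w → length w ≡ n → (∀ t → 1 ≤ t → t ≤ n → 1 ≤ at w t × at w t ≤ n) → w ∈ funs n
∈-funs⁺ n w refl bounded = ∈-words⁺ n (range n) w refl λ x∈w →
  let t , 1≤t , t≤n , eq = ∈⇒at w x∈w
      lo , hi = bounded t 1≤t t≤n
  in subst (_∈ range n) eq (∈-range⁺ lo hi)

-- Products of transpositions

data SwapView (a b x : ℕ) : Set where
  at-a      : x ≡ a → swap a b x ≡ b → SwapView a b x
  at-b      : x ≢ a → x ≡ b → swap a b x ≡ a → SwapView a b x
  elsewhere : x ≢ a → x ≢ b → swap a b x ≡ x → SwapView a b x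

swapView : ∀ a b x → SwapView a b x
swapView a b x with x ≡ᵇ a in x=a
... | true = at-a (≡ᵇ⇒≡ x a (subst T (sym x=a) tt)) (cong (if_then b else (if x ≡ᵇ b then a else x)) x=a)
... | false with x ≡ᵇ b in x=b
...   | true  = at-b (λ e → subst T x=a (≡⇒≡ᵇ x a e)) (≡ᵇ⇒≡ x b (subst T (sym x=b) tt))
                  (trans (cong (if_then b else (if x ≡ᵇ b then a else x)) x=a) (cong (if_then a else x) x=b))
...   | false = elsewhere (λ e → subst T x=a (≡⇒≡ᵇ x a e)) (λ e → subst T x=b (≡⇒≡ᵇ x b e))
                  (trans (cong (if_then b else (if x ≡ᵇ b then a else x)) x=a) (cong (if_then a else x) x=b))

swap-other : ∀ a b x → x ≢ a → x ≢ b → swap a b x ≡ x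
swap-other a b x x≢a x≢b with swapView a b x
... | at-a x≡a _      = ⊥-elim (x≢a x≡a)
... | at-b _ x≡b _    = ⊥-elim (x≢b x≡b)
... | elsewhere _ _ e = e

swap-a : ∀ a b → swap a b a ≡ b
swap-a a b with swapView a b a
... | at-a _ e        = e
... | at-b a≢a _ _    = ⊥-elim (a≢a refl)
... | elsewhere a≢a _ _ = ⊥-elim (a≢a refl)

swap-b : ∀ a b → swap a b b ≡ a
swap-b a b with swapView a b b
... | at-a b≡a e      = trans e b≡a
... | at-b _ _ e      = e
... | elsewhere _ b≢b _ = ⊥-elim (b≢b refl)

swap-involutive : ∀ a b x → swap a b (swap a b x) ≡ x
swap-involutive a b x with swapView a b x
... | at-a refl e     = trans (cong (swap a b) e) (swap-b a b)
... | at-b _ refl e   = trans (cong (swap a b) e) (swap-a a b)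
... | elsewhere _ _ e = trans (cong (swap a b) e) e

swap-self : ∀ a x → swap a a x ≡ x
swap-self a x with swapView a a x
... | at-a x≡a e      = trans e (sym x≡a)
... | at-b x≢a x≡a _  = ⊥-elim (x≢a x≡a)
... | elsewhere _ _ e = e

swap-bounded : ∀ a b x N → 1 ≤ a → a ≤ N → 1 ≤ b → b ≤ N → 1 ≤ x → x ≤ N → 1 ≤ swap a b x × swap a b x ≤ N
swap-bounded a b x N 1≤a a≤N 1≤b b≤N 1≤x x≤N with swapView a b x
... | at-a _ e        rewrite e = 1≤b , b≤N
... | at-b _ _ e      rewrite e = 1≤a , a≤N
... | elsewhere _ _ e rewrite e = 1≤x , x≤N

Subexceedant : ℕ → (ℕ → ℕ) → Set
Subexceedant m g = ∀ i → 1 ≤ i → i ≤ m → 1 ≤ g i × g i ≤ i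

Subexceedant-≤ : ∀ {m m′} g → m′ ≤ m → Subexceedant m g → Subexceedant m′ g
Subexceedant-≤ g m′≤m se i 1≤i i≤m′ = se i 1≤i (≤-trans i≤m′ m′≤m)

Subexceedant-pred : ∀ {m} g → Subexceedant (suc m) g → Subexceedant m g
Subexceedant-pred g = Subexceedant-≤ g (n≤1+n _)

Φ : ℕ → (ℕ → ℕ) → ℕ → ℕ
Φ m g x = foldl (λ y i → swap i (g i) y) x (range m)

Φ-suc : ∀ m g x → Φ (suc m) g x ≡ swap (suc m) (g (suc m)) (Φ m g x)
Φ-suc m g x = trans (cong (foldl (λ y i → swap i (g i) y) x) (range-∷ʳ m))
                    (foldl-∷ʳ (λ y i → swap i (g i) y) x (suc m) (range m))

Φ-bounded : ∀ m g N x → Subexceedant m g → m ≤ N → 1 ≤ x → x ≤ N → 1 ≤ Φ m g x × Φ m g x ≤ N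
Φ-bounded zero    g N x _  _   1≤x x≤N = 1≤x , x≤N
Φ-bounded (suc m) g N x se m<N 1≤x x≤N rewrite Φ-suc m g x =
  let lo , hi   = Φ-bounded m g N x (Subexceedant-pred g se) (<⇒≤ m<N) 1≤x x≤N
      1≤g , g≤m = se (suc m) (s≤s z≤n) ≤-refl
  in swap-bounded (suc m) (g (suc m)) (Φ m g x) N (s≤s z≤n) m<N 1≤g (≤-trans g≤m m<N) lo hi

Φ-fixes-above : ∀ m g x → Subexceedant m g → m < x → Φ m g x ≡ x
Φ-fixes-above zero    g x _  _   = refl
Φ-fixes-above (suc m) g x se m<x
  rewrite Φ-suc m g x | Φ-fixes-above m g x (Subexceedant-pred g se) (<⇒≤ m<x) =
  swap-other (suc m) (g (suc m)) x (λ e → <-irrefl (sym e) m<x)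
    (λ e → <-irrefl (sym e) (≤-<-trans (proj₂ (se (suc m) (s≤s z≤n) ≤-refl)) m<x))

Φ-top : ∀ m g → Subexceedant (suc m) g → Φ (suc m) g (suc m) ≡ g (suc m)
Φ-top m g se rewrite Φ-suc m g (suc m) | Φ-fixes-above m g (suc m) (Subexceedant-pred g se) ≤-refl =
  swap-a (suc m) (g (suc m))

Φ⁻¹ : ℕ → (ℕ → ℕ) → ℕ → ℕ
Φ⁻¹ zero    g y = y
Φ⁻¹ (suc m) g y = Φ⁻¹ m g (swap (suc m) (g (suc m)) y)

Φ-inverseˡ : ∀ m g y → Φ m g (Φ⁻¹ m g y) ≡ y
Φ-inverseˡ zero    g y = refl
Φ-inverseˡ (suc m) g y
  rewrite Φ-suc m g (Φ⁻¹ m g (swap (suc m) (g (suc m)) y)) | Φ-inverseˡ m g (swap (suc m) (g (suc m)) y) =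
  swap-involutive (suc m) (g (suc m)) y

Φ⁻¹-bounded : ∀ m g N y → Subexceedant m g → m ≤ N → 1 ≤ y → y ≤ N → 1 ≤ Φ⁻¹ m g y × Φ⁻¹ m g y ≤ N
Φ⁻¹-bounded zero    g N y _  _   1≤y y≤N = 1≤y , y≤N
Φ⁻¹-bounded (suc m) g N y se m<N 1≤y y≤N =
  let 1≤g , g≤m = se (suc m) (s≤s z≤n) ≤-refl
      lo , hi   = swap-bounded (suc m) (g (suc m)) y N (s≤s z≤n) m<N 1≤g (≤-trans g≤m m<N) 1≤y y≤N
  in Φ⁻¹-bounded m g N _ (Subexceedant-pred g se) (<⇒≤ m<N) lo hi

Φ-injective : ∀ n g h → Subexceedant n g → Subexceedant n h →
              (∀ x → 1 ≤ x → x ≤ n → Φ n g x ≡ Φ n h x) → ∀ i → 1 ≤ i → i ≤ n → g i ≡ h i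
Φ-injective zero    g h _   _   _     (suc i) _   ()
Φ-injective (suc n) g h seg seh Φg≡Φh i 1≤i i≤n = split (m≤n⇒m<n∨m≡n i≤n)
  where
  top : g (suc n) ≡ h (suc n)
  top = trans (sym (Φ-top n g seg)) (trans (Φg≡Φh (suc n) (s≤s z≤n) ≤-refl) (Φ-top n h seh))
  prefix : ∀ x → 1 ≤ x → x ≤ n → Φ n g x ≡ Φ n h x
  prefix x 1≤x x≤n = begin
    Φ n g x                                                    ≡⟨ swap-involutive (suc n) (g (suc n)) _ ⟨
    swap (suc n) (g (suc n)) (swap (suc n) (g (suc n)) (Φ n g x)) ≡⟨ cong (swap (suc n) (g (suc n))) (Φ-suc n g x) ⟨
    swap (suc n) (g (suc n)) (Φ (suc n) g x)                   ≡⟨ cong₂ (swap (suc n)) top (Φg≡Φh x 1≤x (m≤n⇒m≤1+n x≤n)) ⟩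
    swap (suc n) (h (suc n)) (Φ (suc n) h x)                   ≡⟨ cong (swap (suc n) (h (suc n))) (Φ-suc n h x) ⟩
    swap (suc n) (h (suc n)) (swap (suc n) (h (suc n)) (Φ n h x)) ≡⟨ swap-involutive (suc n) (h (suc n)) _ ⟩
    Φ n h x                                                    ∎
    where open ≡-Reasoning
  split : i < suc n ⊎ i ≡ suc n → g i ≡ h i
  split (inj₂ refl)       = top
  split (inj₁ (s≤s i≤n′)) =
    Φ-injective n g h (Subexceedant-pred g seg) (Subexceedant-pred h seh) prefix i 1≤i i≤n′

phi-at : ∀ n f x → 1 ≤ x → x ≤ n → at (phi n f) x ≡ Φ n (at f) x
phi-at n f = at-map-range (Φ n (at f)) n

length-phi : ∀ n f → length (phi n f) ≡ n
length-phi n f = trans (length-map _ (range n)) (length-range n)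

-- The cycles of φ(f) for f ∈ Y_n

Nondecreasing : ℕ → (ℕ → ℕ) → Set
Nondecreasing n g = ∀ i → 1 ≤ i → i < n → g i ≤ g (suc i)

Nondecreasing-mono : ∀ n g → Nondecreasing n g → ∀ a b → 1 ≤ a → a ≤ b → b ≤ n → g a ≤ g b
Nondecreasing-mono n g nd a b 1≤a a≤b b≤n with m≤n⇒m<n∨m≡n a≤b
Nondecreasing-mono n g nd a b       1≤a a≤b b≤n | inj₂ refl        = ≤-refl
Nondecreasing-mono n g nd a (suc b) 1≤a a≤b b<n | inj₁ (s≤s a≤b′) =
  ≤-trans (Nondecreasing-mono n g nd a b 1≤a a≤b′ (<⇒≤ b<n)) (nd b (≤-trans 1≤a a≤b′) b<n)

Idempotent : ℕ → (ℕ → ℕ) → Set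
Idempotent n g = ∀ t → 1 ≤ t → t ≤ n → g (g t) ≡ g t

-- A recursive description of Y_n (see IsY⇔): a value equal to its position
-- opens a new block of equal values.
IsY : ℕ → (ℕ → ℕ) → Set
IsY n g = g 1 ≡ 1 × (∀ i → 1 ≤ i → i < n → g (suc i) ≡ g i ⊎ g (suc i) ≡ suc i)

IsY-subexceedant : ∀ n g → IsY n g → Subexceedant n g
IsY-subexceedant n g (g1≡1 , _) (suc zero) _ _ = subst (λ v → 1 ≤ v × v ≤ 1) (sym g1≡1) (≤-refl , ≤-refl)
IsY-subexceedant n g isY@(_ , step) (suc (suc i)) _ i<n
  with IsY-subexceedant n g isY (suc i) (s≤s z≤n) (<⇒≤ i<n) | step (suc i) (s≤s z≤n) i<n
... | 1≤gi , gi≤i | inj₁ same rewrite same = 1≤gi , m≤n⇒m≤1+n gi≤i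
... | _           | inj₂ new  rewrite new  = s≤s z≤n , ≤-refl

IsY-nondecreasing : ∀ n g → IsY n g → Nondecreasing n g
IsY-nondecreasing n g isY i 1≤i i<n with proj₂ isY i 1≤i i<n
... | inj₁ same = ≤-reflexive (sym same)
... | inj₂ new  = ≤-trans (proj₂ (IsY-subexceedant n g isY i 1≤i (<⇒≤ i<n))) (≤-trans (n≤1+n i) (≤-reflexive (sym new)))

IsY-idempotent : ∀ n g → IsY n g → Idempotent n g
IsY-idempotent n g (g1≡1 , _) (suc zero) _ _ = cong g g1≡1
IsY-idempotent n g isY@(_ , step) (suc (suc t)) _ t<n
  with IsY-idempotent n g isY (suc t) (s≤s z≤n) (<⇒≤ t<n) | step (suc t) (s≤s z≤n) t<n
... | fixed | inj₁ same = trans (cong g same) (trans fixed (sym same))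
... | _     | inj₂ new  = cong g new

IsY⇔ : ∀ n g → 1 ≤ n → IsY n g ⇔ (Subexceedant n g × Nondecreasing n g × Idempotent n g)
IsY⇔ n g 1≤n = mk⇔
  (λ isY → IsY-subexceedant n g isY , IsY-nondecreasing n g isY , IsY-idempotent n g isY)
  (λ (se , nd , idem) → g1≡1 se , step se nd idem)
  where
  g1≡1 : Subexceedant n g → g 1 ≡ 1
  g1≡1 se = ≤-antisym (proj₂ (se 1 ≤-refl 1≤n)) (proj₁ (se 1 ≤-refl 1≤n))
  step : Subexceedant n g → Nondecreasing n g → Idempotent n g →
         ∀ i → 1 ≤ i → i < n → g (suc i) ≡ g i ⊎ g (suc i) ≡ suc i
  step se nd idem i 1≤i i<n with g (suc i) ≟ suc i | g (suc i) ≟ g i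
  ... | yes new | _        = inj₂ new
  ... | no _    | yes same = inj₁ same
  ... | no g≢   | no g≢′   = ⊥-elim (<-irrefl refl (<-≤-trans gi<j j≤gi))
    where
    j = g (suc i)
    1≤j : 1 ≤ j
    1≤j = proj₁ (se (suc i) (s≤s z≤n) i<n)
    j≤i : j ≤ i
    j≤i = ≤-pred (≤∧≢⇒< (proj₂ (se (suc i) (s≤s z≤n) i<n)) g≢)
    gi<j : g i < j
    gi<j = ≤∧≢⇒< (nd i 1≤i i<n) (g≢′ ∘ sym)
    j≤gi : j ≤ g i
    j≤gi = ≤-trans (≤-reflexive (sym (idem (suc i) (s≤s z≤n) i<n)))
                   (Nondecreasing-mono n g nd j i 1≤j j≤i (<⇒≤ i<n))

BlockEnd : ℕ → (ℕ → ℕ) → ℕ → Set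
BlockEnd m g x = x ≡ m ⊎ (x < m × g (suc x) ≡ suc x)

data ΦShape (m : ℕ) (g : ℕ → ℕ) (x y : ℕ) : Set where
  advance : x < m → g (suc x) ≡ g x → y ≡ suc x → ΦShape m g x y
  return  : BlockEnd m g x → y ≡ g x → ΦShape m g x y

ΦShape-newBlock : ∀ m g x y → g (suc m) ≡ suc m → ΦShape m g x y → ΦShape (suc m) g x y
ΦShape-newBlock m g x y new (advance x<m same y≡) = advance (m<n⇒m<1+n x<m) same y≡
ΦShape-newBlock m g x y new (return (inj₁ refl) y≡)            = return (inj₂ (≤-refl , new)) y≡
ΦShape-newBlock m g x y new (return (inj₂ (x<m , new′)) y≡)    = return (inj₂ (m<n⇒m<1+n x<m , new′)) y≡

ΦShape-sameBlock : ∀ n g → IsY n g → ∀ m → m < n → g (suc m) ≡ g m → ∀ x y → 1 ≤ x → x ≤ m →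
                   ΦShape m g x y → ΦShape (suc m) g x (swap (suc m) (g (suc m)) y)
ΦShape-sameBlock n g isY m m<n same x y 1≤x x≤m (advance x<m same′ refl) =
  advance (m<n⇒m<1+n x<m) same′ (swap-other (suc m) (g (suc m)) (suc x) (λ e → <-irrefl (suc-injective e) x<m) suc-x≢)
  where
  suc-x≢ : suc x ≢ g (suc m)
  suc-x≢ e = 1+n≰n (≤-trans (≤-reflexive (trans (sym fixed) same′)) (proj₂ (IsY-subexceedant n g isY x 1≤x (≤-trans x≤m (<⇒≤ m<n)))))
    where
    fixed : g (suc x) ≡ suc x
    fixed = trans (cong g (trans e same)) (trans (IsY-idempotent n g isY m (≤-trans 1≤x x≤m) (<⇒≤ m<n)) (sym (trans e same)))
ΦShape-sameBlock n g isY m m<n same x y 1≤x x≤m (return (inj₁ refl) refl) =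
  advance ≤-refl same (trans (cong (swap (suc m) (g (suc m))) (sym same)) (swap-b (suc m) (g (suc m))))
ΦShape-sameBlock n g isY m m<n same x y 1≤x x≤m (return (inj₂ (x<m , new)) refl) =
  return (inj₂ (m<n⇒m<1+n x<m , new)) (swap-other (suc m) (g (suc m)) (g x) gx≢suc-m gx≢)
  where
  gx≤x : g x ≤ x
  gx≤x = proj₂ (IsY-subexceedant n g isY x 1≤x (≤-trans x≤m (<⇒≤ m<n)))
  gx≢suc-m : g x ≢ suc m
  gx≢suc-m e = <-irrefl e (≤-<-trans gx≤x (m<n⇒m<1+n x<m))
  gx≢ : g x ≢ g (suc m)
  gx≢ e = 1+n≰n (≤-trans (≤-reflexive (sym new))
            (≤-trans (Nondecreasing-mono n g (IsY-nondecreasing n g isY) (suc x) m (s≤s z≤n) x<m (<⇒≤ m<n))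
                     (≤-trans (≤-reflexive (trans (sym same) (sym e))) gx≤x)))

Φ-shape : ∀ n g → IsY n g → ∀ m → m ≤ n → ∀ x → 1 ≤ x → x ≤ m → ΦShape m g x (Φ m g x)
Φ-shape n g isY zero    _   (suc x) _ ()
Φ-shape n g isY (suc m) m<n x 1≤x x≤m rewrite Φ-suc m g x with m≤n⇒m<n∨m≡n x≤m
... | inj₂ refl rewrite Φ-fixes-above m g (suc m) (Subexceedant-≤ g (<⇒≤ m<n) (IsY-subexceedant n g isY)) ≤-refl
                      | swap-a (suc m) (g (suc m)) = return (inj₁ refl) refl
... | inj₁ (s≤s x≤m′) with proj₂ isY m (≤-trans 1≤x x≤m′) m<n
...   | inj₁ same = ΦShape-sameBlock n g isY m m<n same x _ 1≤x x≤m′ (Φ-shape n g isY m (<⇒≤ m<n) x 1≤x x≤m′)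
...   | inj₂ new rewrite new | swap-self (suc m) (Φ m g x) =
          ΦShape-newBlock m g x _ new (Φ-shape n g isY m (<⇒≤ m<n) x 1≤x x≤m′)

Avoids312 : ℕ → (ℕ → ℕ) → Set
Avoids312 n σ = ∀ a b c → 1 ≤ a → a < b → b < c → c ≤ n → σ b < σ c → σ c < σ a → ⊥

Avoids312-cong : ∀ n σ τ → (∀ x → 1 ≤ x → x ≤ n → σ x ≡ τ x) → Avoids312 n σ → Avoids312 n τ
Avoids312-cong n σ τ σ≗τ avoids a b c 1≤a a<b b<c c≤n τb<τc τc<τa =
  avoids a b c 1≤a a<b b<c c≤n (subst₂ _<_ (sym (σ≗τ b 1≤b b≤n)) (sym (σ≗τ c 1≤c c≤n)) τb<τc)
                                (subst₂ _<_ (sym (σ≗τ c 1≤c c≤n)) (sym (σ≗τ a 1≤a a≤n)) τc<τa)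
  where
  1≤b = ≤-trans 1≤a (<⇒≤ a<b)
  1≤c = ≤-trans 1≤b (<⇒≤ b<c)
  b≤n = ≤-trans (<⇒≤ b<c) c≤n
  a≤n = ≤-trans (<⇒≤ a<b) b≤n

module _ (n : ℕ) (g : ℕ → ℕ) (isY : IsY n g) where

  private
    shape : ∀ x → 1 ≤ x → x ≤ n → ΦShape n g x (Φ n g x)
    shape = Φ-shape n g isY n ≤-refl

    g≤id : ∀ x → 1 ≤ x → x ≤ n → g x ≤ x
    g≤id x 1≤x x≤n = proj₂ (IsY-subexceedant n g isY x 1≤x x≤n)

  Φ-≤-suc : ∀ x → 1 ≤ x → x ≤ n → Φ n g x ≤ suc x
  Φ-≤-suc x 1≤x x≤n with shape x 1≤x x≤n
  ... | advance _ _ y≡ = ≤-reflexive y≡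
  ... | return _ y≡    = ≤-trans (≤-reflexive y≡) (m≤n⇒m≤1+n (g≤id x 1≤x x≤n))

  Φ-≥-g : ∀ x → 1 ≤ x → x ≤ n → g x ≤ Φ n g x
  Φ-≥-g x 1≤x x≤n with shape x 1≤x x≤n
  ... | advance _ _ y≡ = ≤-trans (m≤n⇒m≤1+n (g≤id x 1≤x x≤n)) (≤-reflexive (sym y≡))
  ... | return _ y≡    = ≤-reflexive (sym y≡)

  g∘Φ : ∀ x → 1 ≤ x → x ≤ n → g (Φ n g x) ≡ g x
  g∘Φ x 1≤x x≤n with shape x 1≤x x≤n
  ... | advance _ same y≡ = trans (cong g y≡) same
  ... | return _ y≡       = trans (cong g y≡) (IsY-idempotent n g isY x 1≤x x≤n)

  -- In a 312 pattern the last entry c cannot advance (σ a ≤ a + 1 ≤ c),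
  -- so it returns to the start g c ≤ a of its block; then σ b ≥ g b ≥ g c.
  Φ-avoids312 : Avoids312 n (Φ n g)
  Φ-avoids312 a b c 1≤a a<b b<c c≤n = impossible (shape c 1≤c c≤n)
    where
    1≤b = ≤-trans 1≤a (<⇒≤ a<b)
    1≤c = ≤-trans 1≤b (<⇒≤ b<c)
    b≤n = ≤-trans (<⇒≤ b<c) c≤n
    a≤n = ≤-trans (<⇒≤ a<b) b≤n
    σa≤c : Φ n g a ≤ c
    σa≤c = ≤-trans (Φ-≤-suc a 1≤a a≤n) (<-trans a<b b<c)
    impossible : ΦShape n g c (Φ n g c) → Φ n g b < Φ n g c → Φ n g c < Φ n g a → ⊥
    impossible (advance _ _ σc≡) _ σc<σa = 1+n≰n (≤-trans (≤-reflexive (cong suc (sym σc≡))) (≤-trans σc<σa (≤-trans σa≤c (n≤1+n c))))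
    impossible (return _ σc≡) σb<σc σc<σa = 1+n≰n (≤-trans (s≤s (≤-trans gc≤gb (Φ-≥-g b 1≤b b≤n))) (≤-trans σb<σc (≤-reflexive σc≡)))
      where
      gc≤a : g c ≤ a
      gc≤a = ≤-pred (≤-trans (s≤s (≤-reflexive (sym σc≡))) (≤-trans σc<σa (Φ-≤-suc a 1≤a a≤n)))
      gc≤gb : g c ≤ g b
      gc≤gb = ≤-trans (≤-reflexive (sym (IsY-idempotent n g isY c 1≤c c≤n)))
                (Nondecreasing-mono n g (IsY-nondecreasing n g isY) (g c) b
                   (proj₁ (IsY-subexceedant n g isY c 1≤c c≤n)) (≤-trans gc≤a (<⇒≤ a<b)) b≤n)

iter-suc : ∀ σ j x → iter σ (suc j) x ≡ iter σ j (at σ x)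
iter-suc σ zero    x = refl
iter-suc σ (suc j) x = cong (at σ) (iter-suc σ j x)

∈-orbit⁺ : ∀ n σ x j → j < n → iter σ j x ∈ orbit n σ x
∈-orbit⁺ n σ x j j<n = ∈-map⁺ (λ j → iter σ j x) (∈-applyUpTo⁺ id j<n)

∈-orbit⁻ : ∀ n σ x {y} → y ∈ orbit n σ x → ∃[ j ] (j < n × y ≡ iter σ j x)
∈-orbit⁻ n σ x y∈ with ∈-map⁻ (λ j → iter σ j x) y∈
... | _ , j∈ , refl with ∈-applyUpTo⁻ id j∈
...   | j , j<n , refl = j , j<n , refl

fixedPointCount : ℕ → (ℕ → ℕ) → ℕ
fixedPointCount n g = length (filterᵇ (λ x → g x ≡ᵇ x) (range n))

module _ (n : ℕ) (f : List ℕ) (isY : IsY n (at f)) where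

  private
    g = at f
    σ = phi n f

    g≤id : ∀ x → 1 ≤ x → x ≤ n → g x ≤ x
    g≤id x 1≤x x≤n = proj₂ (IsY-subexceedant n g isY x 1≤x x≤n)

  iter-phi-sameBlock : ∀ x → 1 ≤ x → x ≤ n → ∀ j → (1 ≤ iter σ j x × iter σ j x ≤ n) × g (iter σ j x) ≡ g x
  iter-phi-sameBlock x 1≤x x≤n zero = (1≤x , x≤n) , refl
  iter-phi-sameBlock x 1≤x x≤n (suc j) with iter-phi-sameBlock x 1≤x x≤n j
  ... | (lo , hi) , same rewrite phi-at n f (iter σ j x) lo hi =
    Φ-bounded n g n _ (IsY-subexceedant n g isY) ≤-refl lo hi , trans (g∘Φ n g isY _ lo hi) same

  -- The orbit of x climbs to the end of its block and then returns to its start g x.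
  iter-phi-reaches-blockStart : ∀ d x → x + d ≡ n → 1 ≤ x → g x < x →
                                ∃[ j ] (1 ≤ j × j + x ≤ suc n × iter σ j x ≡ g x)
  iter-phi-reaches-blockStart d x x+d≡n 1≤x gx<x with subst (x ≤_) x+d≡n (m≤m+n x d)
  ... | x≤n with Φ-shape n g isY n ≤-refl x 1≤x x≤n
  ...   | return _ σx≡ = 1 , ≤-refl , s≤s x≤n , trans (phi-at n f x 1≤x x≤n) σx≡
  ...   | advance x<n same σx≡ with d
  ...     | zero   = ⊥-elim (<-irrefl (trans (sym (+-identityʳ x)) x+d≡n) x<n)
  ...     | suc d′ with iter-phi-reaches-blockStart d′ (suc x) (trans (sym (+-suc x d′)) x+d≡n) (s≤s z≤n)
                       (subst (_< suc x) (sym same) (m<n⇒m<1+n gx<x))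
  ...       | j , _ , j+x<n , reached = suc j , s≤s z≤n , subst (_≤ suc n) (+-suc j x) j+x<n ,
              trans (iter-suc σ j x) (trans (cong (iter σ j) (trans (phi-at n f x 1≤x x≤n) σx≡)) (trans reached same))

  orbitMinimum⇔fixed : ∀ x → 1 ≤ x → x ≤ n → all (x ≤ᵇ_) (orbit n σ x) ≡ (g x ≡ᵇ x)
  orbitMinimum⇔fixed x 1≤x x≤n = T-ext minimum⇒fixed fixed⇒minimum
    where
    fixed⇒minimum : T (g x ≡ᵇ x) → T (all (x ≤ᵇ_) (orbit n σ x))
    fixed⇒minimum gx≡x = all-intro (x ≤ᵇ_) (orbit n σ x) λ y∈ →
      let j , _ , y≡ = ∈-orbit⁻ n σ x y∈
          (lo , hi) , same = iter-phi-sameBlock x 1≤x x≤n j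
      in ≤⇒≤ᵇ (subst (x ≤_) (sym y≡)
           (≤-trans (≤-reflexive (trans (sym (≡ᵇ⇒≡ _ _ gx≡x)) (sym same))) (g≤id _ lo hi)))
    minimum⇒fixed : T (all (x ≤ᵇ_) (orbit n σ x)) → T (g x ≡ᵇ x)
    minimum⇒fixed minimum with g x ≟ x
    ... | yes gx≡x = ≡⇒≡ᵇ _ _ gx≡x
    ... | no gx≢x = ⊥-elim (1+n≰n (≤-trans gx<x (subst (x ≤_) reached x≤σʲx)))
      where
      gx<x = ≤∧≢⇒< (g≤id x 1≤x x≤n) gx≢x
      2≤x = ≤-trans (s≤s (proj₁ (IsY-subexceedant n g isY x 1≤x x≤n))) gx<x
      walk = iter-phi-reaches-blockStart (n ∸ x) x (m+[n∸m]≡n x≤n) 1≤x gx<x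
      j = proj₁ walk
      reached = proj₂ (proj₂ (proj₂ walk))
      j<n : j < n
      j<n = ≤-pred (≤-trans (≤-reflexive (+-comm 2 j)) (≤-trans (+-monoʳ-≤ j 2≤x) (proj₁ (proj₂ (proj₂ walk)))))
      x≤σʲx : x ≤ iter σ j x
      x≤σʲx = ≤ᵇ⇒≤ _ _ (all-elim (x ≤ᵇ_) minimum (∈-orbit⁺ n σ x j j<n))

  cycles-phi : cycles n σ ≡ fixedPointCount n g
  cycles-phi = cong length (filterᵇ-cong _ _ (range n) λ x∈ →
    let 1≤x , x≤n = ∈-range⁻ x∈ in orbitMinimum⇔fixed _ 1≤x x≤n)

-- Avoiding 312 forces f ∈ Y_n

IsY-constantOnLastBlock : ∀ m g → IsY m g → 1 ≤ m → ∀ t → g m ≤ t → t ≤ m → g t ≡ g m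
IsY-constantOnLastBlock m g isY 1≤m t gm≤t t≤m =
  ≤-antisym (Nondecreasing-mono m g nd t m (≤-trans 1≤gm gm≤t) t≤m ≤-refl)
            (≤-trans (≤-reflexive (sym (IsY-idempotent m g isY m 1≤m ≤-refl)))
                     (Nondecreasing-mono m g nd (g m) t 1≤gm gm≤t t≤m))
  where
  nd  = IsY-nondecreasing m g isY
  1≤gm = proj₁ (IsY-subexceedant m g isY m 1≤m ≤-refl)

-- Suppose g is in Y up to m but jumps at m + 1 to a value v = A + 1 inside the
-- last block (g m < v ≤ m).  From t = m + 1 on, σ = Φ t g keeps σ m = g m and
-- σ A > v, and the position Q sent to v stays beyond m; so A < m < Q is a 312
-- pattern of Φ n g.
module _ (n : ℕ) (g : ℕ → ℕ) (se : Subexceedant n g) (nd : Nondecreasing n g)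
         (m A : ℕ) (m<n : m < n) (jump : g (suc m) ≡ suc A) (gm<v : g m < suc A) (v≤m : suc A ≤ m) (1≤A : 1 ≤ A)
         where

  private
    v = suc A

    Invariant : ℕ → Set
    Invariant t = Φ t g m ≡ g m × v < Φ t g A × ∃[ Q ] (m < Q × Q ≤ t × Φ t g Q ≡ v)

    invariant-suc : ∀ t → m < t → t < n → Invariant t → Invariant (suc t)
    invariant-suc t m<t t<n (σm≡ , v<σA , Q , m<Q , Q≤t , σQ≡) = σm≡′ , v<σA′ , Q′
      where
      w = g (suc t)
      v≤w : v ≤ w
      v≤w = subst (_≤ w) jump (Nondecreasing-mono n g nd (suc m) (suc t) (s≤s z≤n) (m<n⇒m<1+n m<t) t<n)
      v<suc-t : v < suc t
      v<suc-t = ≤-<-trans v≤m (m<n⇒m<1+n m<t)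
      σm≡′ : Φ (suc t) g m ≡ g m
      σm≡′ = trans (Φ-suc t g m) (trans (cong (swap (suc t) w) σm≡)
               (swap-other (suc t) w (g m) (λ e → <-irrefl e (<-trans gm<v v<suc-t)) (λ e → <-irrefl e (≤-trans gm<v v≤w))))
      σA≤t : Φ t g A ≤ t
      σA≤t = proj₂ (Φ-bounded t g t A (Subexceedant-≤ g (<⇒≤ t<n) se) ≤-refl 1≤A
                      (≤-trans (n≤1+n A) (≤-trans v≤m (<⇒≤ m<t))))
      v<σA′ : v < Φ (suc t) g A
      v<σA′ with swapView (suc t) w (Φ t g A)
      ... | at-a e _        = ⊥-elim (1+n≰n (≤-trans (≤-reflexive (sym e)) σA≤t))
      ... | at-b _ _ e      = subst (v <_) (sym (trans (Φ-suc t g A) e)) v<suc-t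
      ... | elsewhere _ _ e = subst (v <_) (sym (trans (Φ-suc t g A) e)) v<σA
      Q′ : ∃[ Q′ ] (m < Q′ × Q′ ≤ suc t × Φ (suc t) g Q′ ≡ v)
      Q′ with w ≟ v
      ... | yes w≡v = suc t , m<n⇒m<1+n m<t , ≤-refl , trans (Φ-top t g (Subexceedant-≤ g t<n se)) w≡v
      ... | no  w≢v = Q , m<Q , m≤n⇒m≤1+n Q≤t ,
            trans (Φ-suc t g Q) (trans (cong (swap (suc t) w) σQ≡)
              (swap-other (suc t) w v (λ e → <-irrefl e v<suc-t) (w≢v ∘ sym)))

    invariant-from : Invariant (suc m) → ∀ t → m < t → t ≤ n → Invariant t
    invariant-from start (suc t) m<t t≤n with m≤n⇒m<n∨m≡n m<t
    ... | inj₂ refl = start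
    ... | inj₁ m<t′ = invariant-suc t (≤-pred m<t′) t≤n (invariant-from start t (≤-pred m<t′) (<⇒≤ t≤n))

  jump-creates-312 : IsY m g → ¬ Avoids312 n (Φ n g)
  jump-creates-312 isY avoids = pattern312 (invariant-from start n m<n ≤-refl)
    where
    pattern312 : Invariant n → ⊥
    pattern312 (σm≡ , v<σA , Q , m<Q , Q≤n , σQ≡) =
      avoids A m Q 1≤A v≤m m<Q Q≤n (subst₂ _<_ (sym σm≡) (sym σQ≡) gm<v) (subst (_< Φ n g A) (sym σQ≡) v<σA)
    1≤m = ≤-trans 1≤A (<⇒≤ v≤m)
    σm≡gm : Φ m g m ≡ g m
    σm≡gm with Φ-shape m g isY m ≤-refl m 1≤m ≤-refl
    ... | advance m<m _ _ = ⊥-elim (<-irrefl refl m<m)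
    ... | return _ y≡     = y≡
    σA≡v : Φ m g A ≡ v
    σA≡v with Φ-shape m g isY m ≤-refl A 1≤A (<⇒≤ v≤m)
    ... | advance _ _ y≡                  = y≡
    ... | return (inj₁ A≡m) _             = ⊥-elim (<-irrefl A≡m v≤m)
    ... | return (inj₂ (_ , gv≡v)) _      =
      ⊥-elim (<-irrefl (sym (trans (sym gv≡v) (IsY-constantOnLastBlock m g isY 1≤m v (<⇒≤ gm<v) v≤m))) gm<v)
    start : Invariant (suc m)
    start = trans (Φ-suc m g m) (trans (cong (swap (suc m) (g (suc m))) σm≡gm)
              (swap-other (suc m) (g (suc m)) (g m) (λ e → <-irrefl e (s≤s (≤-trans (<⇒≤ gm<v) v≤m)))
                 (λ e → <-irrefl (trans e jump) gm<v))) ,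
            subst (v <_) (sym (trans (Φ-suc m g A) (trans (cong₂ (swap (suc m)) jump σA≡v) (swap-b (suc m) v)))) (s≤s v≤m) ,
            suc m , ≤-refl , ≤-refl , trans (Φ-top m g (Subexceedant-≤ g m<n se)) jump

IsY-extend : ∀ m g → IsY m g → g (suc m) ≡ g m ⊎ g (suc m) ≡ suc m → IsY (suc m) g
IsY-extend m g (g1≡1 , step) last = g1≡1 , λ i 1≤i i<m → extend i 1≤i (m≤n⇒m<n∨m≡n (≤-pred i<m))
  where
  extend : ∀ i → 1 ≤ i → i < m ⊎ i ≡ m → g (suc i) ≡ g i ⊎ g (suc i) ≡ suc i
  extend i 1≤i (inj₁ i<m)  = step i 1≤i i<m
  extend i 1≤i (inj₂ refl) = last

avoids312⇒IsY-step : ∀ n g → Subexceedant n g → Nondecreasing n g → Avoids312 n (Φ n g) →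
                  ∀ m → 1 ≤ m → m < n → IsY m g → g (suc m) ≡ g m ⊎ g (suc m) ≡ suc m
avoids312⇒IsY-step n g se nd avoids m 1≤m m<n isY with g (suc m) ≟ g m | g (suc m) ≟ suc m
... | yes same | _       = inj₁ same
... | no _     | yes new = inj₂ new
... | no g≢    | no g≢′  with g (suc m) in jump
...   | zero  = ⊥-elim (1+n≰n (≤-trans (proj₁ (se (suc m) (s≤s z≤n) m<n)) (≤-reflexive jump)))
...   | suc A = ⊥-elim (jump-creates-312 n g se nd m A m<n jump gm<v v≤m 1≤A isY avoids)
  where
  gm<v : g m < suc A
  gm<v = ≤∧≢⇒< (subst (g m ≤_) jump (nd m 1≤m m<n)) (g≢ ∘ sym)
  v≤m : suc A ≤ m
  v≤m = ≤-pred (≤∧≢⇒< (subst (_≤ suc m) jump (proj₂ (se (suc m) (s≤s z≤n) m<n))) g≢′)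
  1≤A : 1 ≤ A
  1≤A = ≤-pred (≤-trans (s≤s (proj₁ (se m 1≤m (<⇒≤ m<n)))) gm<v)

avoids312⇒IsY : ∀ n g → Subexceedant n g → Nondecreasing n g → Avoids312 n (Φ n g) → ∀ m → 1 ≤ m → m ≤ n → IsY m g
avoids312⇒IsY n g se nd avoids (suc zero) _ 1≤n =
  ≤-antisym (proj₂ (se 1 ≤-refl 1≤n)) (proj₁ (se 1 ≤-refl 1≤n)) , λ { (suc i) _ (s≤s ()) }
avoids312⇒IsY n g se nd avoids (suc (suc m)) _ m<n =
  extend (avoids312⇒IsY n g se nd avoids (suc m) (s≤s z≤n) (<⇒≤ m<n))
  where
  extend : IsY (suc m) g → IsY (suc (suc m)) g
  extend isY = IsY-extend (suc m) g isY (avoids312⇒IsY-step n g se nd avoids (suc m) (s≤s z≤n) m<n isY)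

<⇒≤∸1 : ∀ {i n} → i < n → i ≤ n ∸ 1
<⇒≤∸1 {n = suc n} (s≤s i≤n) = i≤n

≤∸1⇒< : ∀ {i n} → 1 ≤ i → i ≤ n ∸ 1 → i < n
≤∸1⇒< {suc i} {zero}  _ ()
≤∸1⇒< {i}     {suc n} _ i≤n = s≤s i≤n

subexcᵇ⇔ : ∀ n f → T (subexcᵇ n f) ⇔ Subexceedant n (at f)
subexcᵇ⇔ n f = mk⇔ sound complete
  where
  bounded : ℕ → Bool
  bounded i = (1 ≤ᵇ at f i) ∧ (at f i ≤ᵇ i)
  sound : T (subexcᵇ n f) → Subexceedant n (at f)
  sound h i 1≤i i≤n with Equivalence.to (T-∧ {1 ≤ᵇ at f i}) (all-elim bounded h (∈-range⁺ 1≤i i≤n))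
  ... | lo , hi = ≤ᵇ⇒≤ 1 (at f i) lo , ≤ᵇ⇒≤ (at f i) i hi
  complete : Subexceedant n (at f) → T (subexcᵇ n f)
  complete se = all-intro bounded (range n) λ {i} i∈ →
    let 1≤i , i≤n = ∈-range⁻ i∈ in Equivalence.from (T-∧ {1 ≤ᵇ at f i}) (≤⇒≤ᵇ (proj₁ (se i 1≤i i≤n)) , ≤⇒≤ᵇ (proj₂ (se i 1≤i i≤n)))

nondecᵇ⇔ : ∀ n f → T (nondecᵇ n f) ⇔ Nondecreasing n (at f)
nondecᵇ⇔ n f = mk⇔ sound complete
  where
  ascends : ℕ → Bool
  ascends i = at f i ≤ᵇ at f (suc i)
  sound : T (nondecᵇ n f) → Nondecreasing n (at f)
  sound h i 1≤i i<n = ≤ᵇ⇒≤ (at f i) (at f (suc i)) (all-elim ascends h (∈-range⁺ 1≤i (<⇒≤∸1 i<n)))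
  complete : Nondecreasing n (at f) → T (nondecᵇ n f)
  complete nd = all-intro ascends (range (n ∸ 1)) λ {i} i∈ →
    let 1≤i , i≤n∸1 = ∈-range⁻ i∈ in ≤⇒≤ᵇ (nd i 1≤i (≤∸1⇒< 1≤i i≤n∸1))

avoids312ᵇ⇔ : ∀ n σ → T (avoids312ᵇ n σ) ⇔ Avoids312 n (at σ)
avoids312ᵇ⇔ n σ = mk⇔ sound complete
  where
  is312 : ℕ → ℕ → ℕ → Bool
  is312 a b c = (a <ᵇ b) ∧ (b <ᵇ c) ∧ (at σ b <ᵇ at σ c) ∧ (at σ c <ᵇ at σ a)
  with-c : ℕ → ℕ → Bool
  with-c a b = any (is312 a b) (range n)
  with-b : ℕ → Bool
  with-b a = any (with-c a) (range n)
  sound : T (avoids312ᵇ n σ) → Avoids312 n (at σ)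
  sound h a b c 1≤a a<b b<c c≤n σb<σc σc<σa = Equivalence.to T-not h
    (any-intro with-b (∈-range⁺ 1≤a a≤n) (any-intro (with-c a) (∈-range⁺ 1≤b b≤n) (any-intro (is312 a b) (∈-range⁺ 1≤c c≤n)
      (Equivalence.from (T-∧ {a <ᵇ b}) (<⇒<ᵇ a<b , Equivalence.from (T-∧ {b <ᵇ c}) (<⇒<ᵇ b<c ,
        Equivalence.from (T-∧ {at σ b <ᵇ at σ c}) (<⇒<ᵇ σb<σc , <⇒<ᵇ σc<σa)))))))
    where
    1≤b = ≤-trans 1≤a (<⇒≤ a<b)
    1≤c = ≤-trans 1≤b (<⇒≤ b<c)
    b≤n = ≤-trans (<⇒≤ b<c) c≤n
    a≤n = ≤-trans (<⇒≤ a<b) b≤n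
  complete : Avoids312 n (at σ) → T (avoids312ᵇ n σ)
  complete avoids = Equivalence.from T-not found⇒⊥
    where
    found⇒⊥ : T (any with-b (range n)) → ⊥
    found⇒⊥ found with any-elim with-b (range n) found
    ... | a , a∈ , h₁ with any-elim (with-c a) (range n) h₁
    ... | b , _ , h₂ with any-elim (is312 a b) (range n) h₂
    ... | c , c∈ , h₃ with Equivalence.to (T-∧ {a <ᵇ b}) h₃
    ... | a<b , h₄ with Equivalence.to (T-∧ {b <ᵇ c}) h₄
    ... | b<c , h₅ with Equivalence.to (T-∧ {at σ b <ᵇ at σ c}) h₅
    ... | σb<σc , σc<σa =
      avoids a b c (proj₁ (∈-range⁻ a∈)) (<ᵇ⇒< a b a<b) (<ᵇ⇒< b c b<c) (proj₂ (∈-range⁻ c∈))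
                   (<ᵇ⇒< (at σ b) (at σ c) σb<σc) (<ᵇ⇒< (at σ c) (at σ a) σc<σa)

isPermᵇ-phi : ∀ n f → Subexceedant n (at f) → T (isPermᵇ n (phi n f))
isPermᵇ-phi n f se = all-intro (λ v → elemᵇ v (phi n f)) (range n) λ v∈ →
  let 1≤v , v≤n = ∈-range⁻ v∈
      lo , hi   = Φ⁻¹-bounded n (at f) n _ se ≤-refl 1≤v v≤n
  in elemᵇ-complete _ (phi n f) (Φ⁻¹ n (at f) _) lo (subst (Φ⁻¹ n (at f) _ ≤_) (sym (length-phi n f)) hi)
       (trans (phi-at n f _ lo hi) (Φ-inverseˡ n (at f) _))

phi-∈-funs : ∀ n f → Subexceedant n (at f) → phi n f ∈ funs n
phi-∈-funs n f se = ∈-funs⁺ n (phi n f) (length-phi n f) λ t 1≤t t≤n →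
  subst (λ z → 1 ≤ z × z ≤ n) (sym (phi-at n f t 1≤t t≤n)) (Φ-bounded n (at f) n t se ≤-refl 1≤t t≤n)

elemᵇ⇔image : ∀ n f v → length f ≡ n → T (elemᵇ v f) ⇔ (∃[ t ] (1 ≤ t × t ≤ n × at f t ≡ v))
elemᵇ⇔image n f v refl = mk⇔ (elemᵇ-sound v f) (λ (t , 1≤t , t≤n , eq) → elemᵇ-complete v f t 1≤t t≤n eq)

imageFixedᵇ : ℕ → List ℕ → Bool
imageFixedᵇ n f = all (λ i → not (elemᵇ i f) ∨ (at f i ≡ᵇ i)) (range n)

imageFixedᵇ⇔ : ∀ n f → f ∈ funs n → T (imageFixedᵇ n f) ⇔ Idempotent n (at f)
imageFixedᵇ⇔ n f f∈ = mk⇔ sound complete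
  where
  len = proj₁ (∈-funs⁻ n f∈)
  bounded = proj₂ (∈-funs⁻ n f∈)
  fixedIfImage : ℕ → Bool
  fixedIfImage i = not (elemᵇ i f) ∨ (at f i ≡ᵇ i)
  sound : T (imageFixedᵇ n f) → Idempotent n (at f)
  sound h t 1≤t t≤n with Equivalence.to (T-∨ {not (elemᵇ (at f t) f)})
                           (all-elim fixedIfImage h (∈-range⁺ (proj₁ (bounded t 1≤t t≤n)) (proj₂ (bounded t 1≤t t≤n))))
  ... | inj₁ notImage = ⊥-elim (Equivalence.to T-not notImage (Equivalence.from (elemᵇ⇔image n f _ len) (t , 1≤t , t≤n , refl)))
  ... | inj₂ fixed    = ≡ᵇ⇒≡ _ _ fixed
  complete : Idempotent n (at f) → T (imageFixedᵇ n f)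
  complete idem = all-intro fixedIfImage (range n) λ {i} _ → fixed i
    where
    fixed : ∀ i → T (not (elemᵇ i f) ∨ (at f i ≡ᵇ i))
    fixed i with elemᵇ i f in image
    ... | false = tt
    ... | true with Equivalence.to (elemᵇ⇔image n f i len) (subst T (sym image) tt)
    ...   | t , 1≤t , t≤n , refl = ≡⇒≡ᵇ _ _ (idem t 1≤t t≤n)

IsY⇒∈-funs : ∀ n f → length f ≡ n → IsY n (at f) → f ∈ funs n
IsY⇒∈-funs n f len isY = ∈-funs⁺ n f len λ t 1≤t t≤n →
  let lo , hi = IsY-subexceedant n (at f) isY t 1≤t t≤n in lo , ≤-trans hi t≤n

∈-Fnd⇔ : ∀ n {f} → f ∈ Fnd n ⇔ (f ∈ funs n × Subexceedant n (at f) × Nondecreasing n (at f))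
∈-Fnd⇔ n {f} = mk⇔
  (λ f∈ → let f∈F , nd = ∈-filterᵇ⁻ (nondecᵇ n) f∈ ; f∈funs , se = ∈-filterᵇ⁻ (subexcᵇ n) f∈F in
    f∈funs , Equivalence.to (subexcᵇ⇔ n f) se , Equivalence.to (nondecᵇ⇔ n f) nd)
  (λ (f∈funs , se , nd) →
    ∈-filterᵇ⁺ (nondecᵇ n) (∈-filterᵇ⁺ (subexcᵇ n) f∈funs (Equivalence.from (subexcᵇ⇔ n f) se))
               (Equivalence.from (nondecᵇ⇔ n f) nd))

∈-Y⇔ : ∀ n {f} → 1 ≤ n → f ∈ Y n ⇔ (f ∈ funs n × IsY n (at f))
∈-Y⇔ n {f} 1≤n = mk⇔
  (λ f∈ → let f∈Fnd , fixes = ∈-filterᵇ⁻ (imageFixedᵇ n) f∈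
              f∈funs , se , nd = Equivalence.to (∈-Fnd⇔ n) f∈Fnd
          in f∈funs , Equivalence.from (IsY⇔ n (at f) 1≤n) (se , nd , Equivalence.to (imageFixedᵇ⇔ n f f∈funs) fixes))
  (λ (f∈funs , isY) → let se , nd , idem = Equivalence.to (IsY⇔ n (at f) 1≤n) isY in
    ∈-filterᵇ⁺ (imageFixedᵇ n) (Equivalence.from (∈-Fnd⇔ n) (f∈funs , se , nd))
               (Equivalence.from (imageFixedᵇ⇔ n f f∈funs) idem))

Y-unique : ∀ n → Unique (Y n)
Y-unique n = filterᵇ-unique (imageFixedᵇ n) (filterᵇ-unique (nondecᵇ n) (filterᵇ-unique (subexcᵇ n) (funs-unique n)))

IMA≡fixedPointCount : ∀ n f → length f ≡ n → IsY n (at f) → IMA n f ≡ fixedPointCount n (at f)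
IMA≡fixedPointCount n f len isY = cong length (filterᵇ-cong _ _ (range n) λ {v} v∈ →
  let 1≤v , v≤n = ∈-range⁻ v∈ in
  T-ext (λ image → let t , 1≤t , t≤n , eq = Equivalence.to (elemᵇ⇔image n f v len) image in
                   ≡⇒≡ᵇ _ _ (trans (cong (at f) (sym eq)) (trans (IsY-idempotent n (at f) isY t 1≤t t≤n) eq)))
        (λ fixed → Equivalence.from (elemᵇ⇔image n f v len) (v , 1≤v , v≤n , ≡ᵇ⇒≡ _ _ fixed)))

YIMA : ℕ → ℕ → List (List ℕ)
YIMA n k = filterᵇ (λ f → IMA n f ≡ᵇ k) (Y n)

∈-YIMA⇔ : ∀ n k {f} → 1 ≤ n → f ∈ YIMA n k ⇔ (f ∈ funs n × IsY n (at f) × fixedPointCount n (at f) ≡ k)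
∈-YIMA⇔ n k {f} 1≤n = mk⇔
  (λ f∈ → let f∈Y , imaᵇ = ∈-filterᵇ⁻ (λ f → IMA n f ≡ᵇ k) f∈
              f∈funs , isY = Equivalence.to (∈-Y⇔ n 1≤n) f∈Y
          in f∈funs , isY , trans (sym (IMA≡fixedPointCount n f (proj₁ (∈-funs⁻ n f∈funs)) isY)) (≡ᵇ⇒≡ _ _ imaᵇ))
  (λ (f∈funs , isY , count) →
    ∈-filterᵇ⁺ (λ f → IMA n f ≡ᵇ k) (Equivalence.from (∈-Y⇔ n 1≤n) (f∈funs , isY))
               (≡⇒≡ᵇ _ _ (trans (IMA≡fixedPointCount n f (proj₁ (∈-funs⁻ n f∈funs)) isY) count)))

YIMA-unique : ∀ n k → Unique (YIMA n k)
YIMA-unique n k = filterᵇ-unique (λ f → IMA n f ≡ᵇ k) (Y-unique n)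

phi-injective : ∀ n f f′ → f ∈ funs n → f′ ∈ funs n → Subexceedant n (at f) → Subexceedant n (at f′) →
                phi n f ≡ phi n f′ → f ≡ f′
phi-injective n f f′ f∈ f′∈ se se′ eq =
  at-ext f f′ (trans len (sym len′)) λ t 1≤t t≤ → Φ-injective n (at f) (at f′) se se′
    (λ x 1≤x x≤n → trans (sym (phi-at n f x 1≤x x≤n)) (trans (cong (λ σ → at σ x) eq) (phi-at n f′ x 1≤x x≤n)))
    t 1≤t (subst (t ≤_) len t≤)
  where
  len = proj₁ (∈-funs⁻ n f∈)
  len′ = proj₁ (∈-funs⁻ n f′∈)

Avoids312-phi⇔Φ : ∀ n f → T (avoids312ᵇ n (phi n f)) ⇔ Avoids312 n (Φ n (at f))
Avoids312-phi⇔Φ n f = mk⇔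
  (λ h → Avoids312-cong n (at (phi n f)) (Φ n (at f)) (phi-at n f) (Equivalence.to (avoids312ᵇ⇔ n (phi n f)) h))
  (λ avoids → Equivalence.from (avoids312ᵇ⇔ n (phi n f))
                (Avoids312-cong n (Φ n (at f)) (at (phi n f)) (λ x 1≤x x≤n → sym (phi-at n f x 1≤x x≤n)) avoids))

counted312 : ℕ → ℕ → List ℕ → Bool
counted312 n k σ = isPermᵇ n σ ∧ inSnUpᵇ n σ ∧ avoids312ᵇ n σ ∧ (cycles n σ ≡ᵇ k)

module _ (n k : ℕ) (1≤n : 1 ≤ n) where

  private
    ∈-YIMA⁻ : ∀ {f} → f ∈ YIMA n k → f ∈ funs n × IsY n (at f) × fixedPointCount n (at f) ≡ k
    ∈-YIMA⁻ = Equivalence.to (∈-YIMA⇔ n k 1≤n)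

  phi-onto-312 : ∀ {σ} → σ ∈ filterᵇ (counted312 n k) (funs n) → σ ∈ map (phi n) (YIMA n k)
  phi-onto-312 {σ} σ∈ with ∈-filterᵇ⁻ (counted312 n k) {funs n} σ∈
  ... | _ , h₁ with Equivalence.to (T-∧ {isPermᵇ n σ}) h₁
  ... | _ , h₂ with Equivalence.to (T-∧ {inSnUpᵇ n σ}) h₂
  ... | inSnUp , h₃ with Equivalence.to (T-∧ {avoids312ᵇ n σ}) h₃
  ... | avoids , cyclesᵇ with any-elim (λ f → eqListᵇ (phi n f) σ) (Fnd n) inSnUp
  ... | f , f∈Fnd , phiᵇ with eqListᵇ-sound (phi n f) σ phiᵇ
  ... | refl = ∈-map⁺ (phi n) (Equivalence.from (∈-YIMA⇔ n k 1≤n) (f∈funs , isY , count))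
    where
    f∈funs = proj₁ (Equivalence.to (∈-Fnd⇔ n) f∈Fnd)
    isY : IsY n (at f)
    isY = avoids312⇒IsY n (at f) (proj₁ (proj₂ (Equivalence.to (∈-Fnd⇔ n) f∈Fnd)))
            (proj₂ (proj₂ (Equivalence.to (∈-Fnd⇔ n) f∈Fnd))) (Equivalence.to (Avoids312-phi⇔Φ n f) avoids) n 1≤n ≤-refl
    count : fixedPointCount n (at f) ≡ k
    count = trans (sym (cycles-phi n f isY)) (≡ᵇ⇒≡ _ _ cyclesᵇ)

  phi-into-312 : ∀ {σ} → σ ∈ map (phi n) (YIMA n k) → σ ∈ filterᵇ (counted312 n k) (funs n)
  phi-into-312 σ∈ with ∈-map⁻ (phi n) σ∈
  ... | f , f∈ , refl with ∈-YIMA⁻ f∈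
  ... | f∈funs , isY , count = ∈-filterᵇ⁺ (counted312 n k) (phi-∈-funs n f se)
        (Equivalence.from (T-∧ {isPermᵇ n (phi n f)}) (isPermᵇ-phi n f se ,
         Equivalence.from (T-∧ {inSnUpᵇ n (phi n f)}) (any-intro (λ f′ → eqListᵇ (phi n f′) (phi n f)) f∈Fnd (eqListᵇ-refl (phi n f)) ,
         Equivalence.from (T-∧ {avoids312ᵇ n (phi n f)}) (Equivalence.from (Avoids312-phi⇔Φ n f) (Φ-avoids312 n (at f) isY) ,
                                                         ≡⇒≡ᵇ _ _ (trans (cycles-phi n f isY) count)))))
    where
    se = IsY-subexceedant n (at f) isY
    f∈Fnd = Equivalence.from (∈-Fnd⇔ n) (f∈funs , se , IsY-nondecreasing n (at f) isY)

  phi-YIMA-unique : Unique (map (phi n) (YIMA n k))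
  phi-YIMA-unique = map-unique-on (phi n) injective (YIMA-unique n k)
    where
    injective : ∀ {f f′} → f ∈ YIMA n k → f′ ∈ YIMA n k → phi n f ≡ phi n f′ → f ≡ f′
    injective f∈ f′∈ with ∈-YIMA⁻ f∈ | ∈-YIMA⁻ f′∈
    ... | f∈funs , isY , _ | f′∈funs , isY′ , _ =
      phi-injective n _ _ f∈funs f′∈funs (IsY-subexceedant n _ isY) (IsY-subexceedant n _ isY′)

  count312≡countY : count312 n k ≡ countY n k
  count312≡countY = begin
    count312 n k                          ≡⟨ length-unique (filterᵇ-unique (counted312 n k) (funs-unique n)) phi-YIMA-unique
                                                            (mk⇔ phi-onto-312 phi-into-312) ⟩
    length (map (phi n) (YIMA n k))       ≡⟨ length-map (phi n) (YIMA n k) ⟩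
    countY n k                            ∎
    where open ≡-Reasoning

-- Counting Y_n by block starts

-- Continues p v xs: xs is the tail, starting at position p + 1, of a Y-function
-- whose value at position p is v.
Continues : ℕ → ℕ → List ℕ → Set
Continues p v []       = ⊤
Continues p v (x ∷ xs) = (x ≡ v ⊎ x ≡ suc p) × Continues (suc p) x xs

newBlocks : ℕ → List ℕ → ℕ
newBlocks p []       = 0
newBlocks p (x ∷ xs) = (if x ≡ᵇ suc p then 1 else 0) + newBlocks (suc p) xs

continuations : ℕ → ℕ → ℕ → ℕ → List (List ℕ)
continuations p v zero    zero    = [] ∷ []
continuations p v zero    (suc j) = []
continuations p v (suc m) zero    = map (v ∷_) (continuations (suc p) v m zero)
continuations p v (suc m) (suc j) =
  map (v ∷_) (continuations (suc p) v m (suc j)) ++ map (suc p ∷_) (continuations (suc p) (suc p) m j)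

length-continuations : ∀ p v m j → length (continuations p v m j) ≡ m C j
length-continuations p v zero    zero    = refl
length-continuations p v zero    (suc j) = refl
length-continuations p v (suc m) zero    =
  trans (length-map _ (continuations (suc p) v m zero)) (length-continuations (suc p) v m zero)
length-continuations p v (suc m) (suc j) = begin
  length (map (v ∷_) old ++ map (suc p ∷_) new) ≡⟨ length-++ (map (v ∷_) old) ⟩
  length (map (v ∷_) old) + length (map (suc p ∷_) new)
    ≡⟨ cong₂ _+_ (length-map _ old) (length-map _ new) ⟩
  length old + length new
    ≡⟨ cong₂ _+_ (length-continuations (suc p) v m (suc j)) (length-continuations (suc p) (suc p) m j) ⟩
  m C suc j + m C j                              ≡⟨ +-comm (m C suc j) (m C j) ⟩
  m C j + m C suc j                              ≡⟨ nCk+nC[k+1]≡[n+1]C[k+1] m j ⟩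
  suc m C suc j                                  ∎
  where
  open ≡-Reasoning
  old = continuations (suc p) v m (suc j)
  new = continuations (suc p) (suc p) m j

newBlocks-repeat : ∀ p v ys → v ≤ p → newBlocks p (v ∷ ys) ≡ newBlocks (suc p) ys
newBlocks-repeat p v ys v≤p with v ≡ᵇ suc p in eq
... | false = refl
... | true  = ⊥-elim (1+n≰n (≤-trans (≤-reflexive (sym (≡ᵇ⇒≡ v (suc p) (subst T (sym eq) tt)))) v≤p))

newBlocks-new : ∀ p ys → newBlocks p (suc p ∷ ys) ≡ suc (newBlocks (suc p) ys)
newBlocks-new p ys rewrite Equivalence.to T-≡ (≡⇒≡ᵇ p p refl) = refl

∈-continuations⁻ : ∀ p v m j {xs} → v ≤ p → xs ∈ continuations p v m j →
                   length xs ≡ m × Continues p v xs × newBlocks p xs ≡ j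
∈-continuations⁻ p v zero zero _ (here refl) = refl , tt , refl
∈-continuations⁻ p v (suc m) zero v≤p xs∈ with ∈-map⁻ (v ∷_) xs∈
... | ys , ys∈ , refl with ∈-continuations⁻ (suc p) v m zero (m≤n⇒m≤1+n v≤p) ys∈
...   | len , cont , blocks = cong suc len , (inj₁ refl , cont) , trans (newBlocks-repeat p v ys v≤p) blocks
∈-continuations⁻ p v (suc m) (suc j) v≤p xs∈ with ∈-++⁻ (map (v ∷_) (continuations (suc p) v m (suc j))) xs∈
... | inj₁ xs∈old with ∈-map⁻ (v ∷_) xs∈old
...   | ys , ys∈ , refl with ∈-continuations⁻ (suc p) v m (suc j) (m≤n⇒m≤1+n v≤p) ys∈
...     | len , cont , blocks = cong suc len , (inj₁ refl , cont) , trans (newBlocks-repeat p v ys v≤p) blocks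
∈-continuations⁻ p v (suc m) (suc j) v≤p xs∈ | inj₂ xs∈new with ∈-map⁻ (suc p ∷_) xs∈new
...   | ys , ys∈ , refl with ∈-continuations⁻ (suc p) (suc p) m j ≤-refl ys∈
...     | len , cont , blocks = cong suc len , (inj₂ refl , cont) , trans (newBlocks-new p ys) (cong suc blocks)

∈-continuations⁺ : ∀ p v m j xs → v ≤ p → length xs ≡ m → Continues p v xs → newBlocks p xs ≡ j →
                   xs ∈ continuations p v m j
∈-continuations⁺ p v zero zero [] _ refl _ _ = here refl
∈-continuations⁺ p v (suc m) zero (x ∷ xs) v≤p len (inj₁ refl , cont) blocks =
  ∈-map⁺ (v ∷_) (∈-continuations⁺ (suc p) v m zero xs (m≤n⇒m≤1+n v≤p) (suc-injective len) cont
                   (trans (sym (newBlocks-repeat p v xs v≤p)) blocks))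
∈-continuations⁺ p v (suc m) (suc j) (x ∷ xs) v≤p len (inj₁ refl , cont) blocks =
  ∈-++⁺ˡ (∈-map⁺ (v ∷_) (∈-continuations⁺ (suc p) v m (suc j) xs (m≤n⇒m≤1+n v≤p) (suc-injective len) cont
                           (trans (sym (newBlocks-repeat p v xs v≤p)) blocks)))
∈-continuations⁺ p v (suc m) (suc j) (x ∷ xs) v≤p len (inj₂ refl , cont) blocks =
  ∈-++⁺ʳ (map (v ∷_) (continuations (suc p) v m (suc j)))
    (∈-map⁺ (suc p ∷_) (∈-continuations⁺ (suc p) (suc p) m j xs ≤-refl (suc-injective len) cont
                          (suc-injective (trans (sym (newBlocks-new p xs)) blocks))))
∈-continuations⁺ p v (suc m) zero (x ∷ xs) v≤p len (inj₂ refl , cont) blocks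
  with () ← trans (sym (newBlocks-new p xs)) blocks

continuations-unique : ∀ p v m j → v ≤ p → Unique (continuations p v m j)
continuations-unique p v zero    zero    _   = All.[] ∷ []
continuations-unique p v zero    (suc j) _   = []
continuations-unique p v (suc m) zero    v≤p = Unique.map⁺ ∷-injectiveʳ (continuations-unique (suc p) v m zero (m≤n⇒m≤1+n v≤p))
continuations-unique p v (suc m) (suc j) v≤p =
  Unique.++⁺ (Unique.map⁺ ∷-injectiveʳ (continuations-unique (suc p) v m (suc j) (m≤n⇒m≤1+n v≤p)))
             (Unique.map⁺ ∷-injectiveʳ (continuations-unique (suc p) (suc p) m j ≤-refl))
             λ (old , new) → disjoint old new
  where
  disjoint : ∀ {xs} → xs ∈ map (v ∷_) (continuations (suc p) v m (suc j)) → xs ∈ map (suc p ∷_) (continuations (suc p) (suc p) m j) → ⊥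
  disjoint old new with ∈-map⁻ (v ∷_) old | ∈-map⁻ (suc p ∷_) new
  ... | _ , _ , refl | _ , _ , eq = 1+n≰n (≤-trans (≤-reflexive (∷-injectiveˡ (sym eq))) v≤p)

filterᵇ-map : ∀ {A B : Set} (q : B → Bool) (h : A → B) xs → filterᵇ q (map h xs) ≡ map h (filterᵇ (q ∘ h) xs)
filterᵇ-map q h []       = refl
filterᵇ-map q h (x ∷ xs) with q (h x)
... | true  = cong (h x ∷_) (filterᵇ-map q h xs)
... | false = filterᵇ-map q h xs

shiftedFixedPoints : ℕ → List ℕ → ℕ
shiftedFixedPoints p xs = length (filterᵇ (λ t → at xs t ≡ᵇ p + t) (range (length xs)))

shiftedFixedPoints≡newBlocks : ∀ p xs → shiftedFixedPoints p xs ≡ newBlocks p xs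
shiftedFixedPoints≡newBlocks p []       = refl
shiftedFixedPoints≡newBlocks p (x ∷ xs) = begin
  length (filterᵇ q (range (suc (length xs))))
    ≡⟨ cong (length ∘ filterᵇ q) (range-∷ (length xs)) ⟩
  length (filterᵇ q (1 ∷ map suc (range (length xs))))
    ≡⟨ head-and-tail (x ≡ᵇ suc p) (cong (x ≡ᵇ_) (+-comm p 1)) ⟩
  (if x ≡ᵇ suc p then 1 else 0) + length (filterᵇ q (map suc (range (length xs))))
    ≡⟨ cong (λ l → (if x ≡ᵇ suc p then 1 else 0) + l) shift ⟩
  (if x ≡ᵇ suc p then 1 else 0) + shiftedFixedPoints (suc p) xs
    ≡⟨ cong ((if x ≡ᵇ suc p then 1 else 0) +_) (shiftedFixedPoints≡newBlocks (suc p) xs) ⟩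
  newBlocks p (x ∷ xs) ∎
  where
  open ≡-Reasoning
  q : ℕ → Bool
  q t = at (x ∷ xs) t ≡ᵇ p + t
  head-and-tail : ∀ b → q 1 ≡ b → length (filterᵇ q (1 ∷ map suc (range (length xs))))
                                    ≡ (if b then 1 else 0) + length (filterᵇ q (map suc (range (length xs))))
  head-and-tail b q1≡b with q 1
  head-and-tail true  refl | true  = refl
  head-and-tail false refl | false = refl
  shift : length (filterᵇ q (map suc (range (length xs)))) ≡ shiftedFixedPoints (suc p) xs
  shift = begin
    length (filterᵇ q (map suc (range (length xs))))       ≡⟨ cong length (filterᵇ-map q suc (range (length xs))) ⟩
    length (map suc (filterᵇ (q ∘ suc) (range (length xs)))) ≡⟨ length-map suc (filterᵇ (q ∘ suc) (range (length xs))) ⟩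
    length (filterᵇ (q ∘ suc) (range (length xs)))         ≡⟨ cong length (filterᵇ-cong (q ∘ suc) (λ t → at xs t ≡ᵇ suc p + t) (range (length xs))
                                                                 λ t∈ → cong₂ _≡ᵇ_ (at-∷ x xs _ (proj₁ (∈-range⁻ t∈))) (+-suc p _)) ⟩
    shiftedFixedPoints (suc p) xs                          ∎

fixedPointCount-∷ : ∀ n′ xs → length xs ≡ n′ → fixedPointCount (suc n′) (at (1 ∷ xs)) ≡ suc (newBlocks 1 xs)
fixedPointCount-∷ _ xs refl = shiftedFixedPoints≡newBlocks 0 (1 ∷ xs)

Continues⇔steps : ∀ p v xs → Continues p v xs ⇔
  (∀ t → 1 ≤ t → t ≤ length xs → at (v ∷ xs) (suc t) ≡ at (v ∷ xs) t ⊎ at (v ∷ xs) (suc t) ≡ p + t)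
Continues⇔steps p v xs = mk⇔ (sound p v xs) (complete p v xs)
  where
  sound : ∀ p v xs → Continues p v xs →
          ∀ t → 1 ≤ t → t ≤ length xs → at (v ∷ xs) (suc t) ≡ at (v ∷ xs) t ⊎ at (v ∷ xs) (suc t) ≡ p + t
  sound p v (x ∷ xs) (inj₁ same , _) (suc zero) _ _ = inj₁ same
  sound p v (x ∷ xs) (inj₂ new  , _) (suc zero) _ _ = inj₂ (trans new (+-comm 1 p))
  sound p v (x ∷ xs) (_ , cont) (suc (suc t)) _ (s≤s t≤) with sound (suc p) x xs cont (suc t) (s≤s z≤n) t≤
  ... | inj₁ same = inj₁ same
  ... | inj₂ new  = inj₂ (trans new (sym (+-suc p (suc t))))
  complete : ∀ p v xs →
             (∀ t → 1 ≤ t → t ≤ length xs → at (v ∷ xs) (suc t) ≡ at (v ∷ xs) t ⊎ at (v ∷ xs) (suc t) ≡ p + t) →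
             Continues p v xs
  complete p v []       _     = tt
  complete p v (x ∷ xs) steps = first (steps 1 ≤-refl (s≤s z≤n)) , complete (suc p) x xs rest
    where
    first : x ≡ v ⊎ x ≡ p + 1 → x ≡ v ⊎ x ≡ suc p
    first (inj₁ same) = inj₁ same
    first (inj₂ new)  = inj₂ (trans new (+-comm p 1))
    rest : ∀ t → 1 ≤ t → t ≤ length xs → at (x ∷ xs) (suc t) ≡ at (x ∷ xs) t ⊎ at (x ∷ xs) (suc t) ≡ suc p + t
    rest (suc t) _ t≤ with steps (suc (suc t)) (s≤s z≤n) (s≤s t≤)
    ... | inj₁ same = inj₁ same
    ... | inj₂ new  = inj₂ (trans new (+-suc p (suc t)))

IsY-∷⇔ : ∀ n′ xs → length xs ≡ n′ → IsY (suc n′) (at (1 ∷ xs)) ⇔ Continues 1 1 xs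
IsY-∷⇔ _ xs refl = mk⇔
  (λ (_ , steps) → Equivalence.from (Continues⇔steps 1 1 xs) λ t 1≤t t≤ → steps t 1≤t (s≤s t≤))
  (λ cont → refl , λ i 1≤i i<n → Equivalence.to (Continues⇔steps 1 1 xs) cont i 1≤i (≤-pred i<n))

YIMA-∷⇔continuations : ∀ n′ k′ {f} → f ∈ YIMA (suc n′) (suc k′) ⇔ f ∈ map (1 ∷_) (continuations 1 1 n′ k′)
YIMA-∷⇔continuations n′ k′ = mk⇔ to from
  where
  n = suc n′
  to : ∀ {f} → f ∈ YIMA n (suc k′) → f ∈ map (1 ∷_) (continuations 1 1 n′ k′)
  to {f} f∈ with Equivalence.to (∈-YIMA⇔ n (suc k′) (s≤s z≤n)) f∈
  ... | f∈funs , isY , count with f | proj₁ (∈-funs⁻ n f∈funs) | isY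
  ... | x ∷ xs | len | refl , steps = ∈-map⁺ (1 ∷_) (∈-continuations⁺ 1 1 n′ k′ xs ≤-refl (suc-injective len)
          (Equivalence.to (IsY-∷⇔ n′ xs (suc-injective len)) (refl , steps))
          (suc-injective (trans (sym (fixedPointCount-∷ n′ xs (suc-injective len))) count)))
  from : ∀ {f} → f ∈ map (1 ∷_) (continuations 1 1 n′ k′) → f ∈ YIMA n (suc k′)
  from f∈ with ∈-map⁻ (1 ∷_) f∈
  ... | xs , xs∈ , refl with ∈-continuations⁻ 1 1 n′ k′ ≤-refl xs∈
  ... | len , cont , blocks = Equivalence.from (∈-YIMA⇔ n (suc k′) (s≤s z≤n))
          (IsY⇒∈-funs n (1 ∷ xs) (cong suc len) isY , isY ,
           trans (fixedPointCount-∷ n′ xs len) (cong suc blocks))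
    where
    isY = Equivalence.from (IsY-∷⇔ n′ xs len) cont

countY≡binomial : ∀ n′ k′ → countY (suc n′) (suc k′) ≡ n′ C k′
countY≡binomial n′ k′ = begin
  countY (suc n′) (suc k′)
    ≡⟨ length-unique (YIMA-unique (suc n′) (suc k′)) (Unique.map⁺ ∷-injectiveʳ (continuations-unique 1 1 n′ k′ ≤-refl))
                     (YIMA-∷⇔continuations n′ k′) ⟩
  length (map (1 ∷_) (continuations 1 1 n′ k′)) ≡⟨ length-map (1 ∷_) (continuations 1 1 n′ k′) ⟩
  length (continuations 1 1 n′ k′)               ≡⟨ length-continuations 1 1 n′ k′ ⟩
  n′ C k′                                        ∎
  where open ≡-Reasoning

-- The bound k ≤ n ∸ 1 is only needed to rule out n = 0.
corollary5p3 : (n k : ℕ) → 1 ≤ k → k ≤ n ∸ 1 →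
    (count312 n k ≡ countY n k) × (countY n k ≡ (n ∸ 1) C (k ∸ 1))
corollary5p3 zero     (suc k′) _ ()
corollary5p3 (suc n′) (suc k′) _ _ = count312≡countY (suc n′) (suc k′) (s≤s z≤n) , countY≡binomial n′ k′
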